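{- Let $G$ be a connected graph, let $X\subseteq V(G)$ be a twin cover of $G$, and let $\varphi$ be a proper coloring of $G[X]$. Then the minimum number of colors used by a proper coloring of $G$ whose restriction to $X$ equals $\varphi$ is exactly \[ K_\varphi=\max_{S\subseteq X}\bigl(|\varphi(S)|+m(S)\bigr). \]
   Context: All graphs are finite, simple and undirected. Vertices $u\neq v$ are true twins if $N_G[u]=N_G[v]$; a twin edge is an edge whose endpoints are true twins; $X\subseteq V(G)$ is a twin cover of $G$ if every edge of $G-X$ is a twin edge. A twin-clique is a connected component of $G-X$; each twin-clique $C$ is a clique whose vertices all have the same neighborhood in $X$, denoted $N_X(C)$. For $S\subseteq X$, $m(S)$ is the maximum size $|C|$ of a twin-clique $C$ with $N_X(C)=S$, and $m(S)=0$ if no such twin-clique exists. $\varphi(S):=\{\varphi(x):x\in S\}$. -}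

module Defs where

open import Level using (0ℓ)
open import Data.Nat using (ℕ; _+_; _≤_)
import Data.Nat as ℕ
open import Data.Fin using (Fin)
open import Data.Fin.Subset using (Subset; _∈_; _∉_; ⊤; ∣_∣)
open import Data.Fin.Subset.Properties using (_∈?_)
open import Data.List using (List; length; map; filter; deduplicate; allFin)
open import Data.Product using (Σ; ∃; ∃-syntax; _×_; _,_)
open import Data.Sum using (_⊎_)
open import Data.Unit using () renaming (⊤ to Unit)
open import Relation.Nullary using (¬_)
open import Relation.Binary using (Rel; Decidable; Symmetric)
open import Relation.Binary.PropositionalEquality using (_≡_; _≢_)
open import Function.Bundles using (_⇔_)

record Graph (n : ℕ) : Set₁ where
  field
    Adj    : Rel (Fin n) 0ℓ
    sym    : Symmetric Adj
    irrefl : ∀ v → ¬ Adj v v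
    dec    : Decidable Adj
open Graph public

module _ {n : ℕ} (G : Graph n) where

  data WalkIn (P : Fin n → Set) : Fin n → Fin n → Set where
    here : ∀ {u} → P u → WalkIn P u u
    step : ∀ {u w v} → P u → Adj G u w → WalkIn P w v → WalkIn P u v

  Connected : Set
  Connected = ∀ u v → WalkIn (λ _ → Unit) u v

  InClosedNbhd : Fin n → Fin n → Set
  InClosedNbhd u w = (w ≡ u) ⊎ Adj G u w

  TrueTwins : Fin n → Fin n → Set
  TrueTwins u v = (u ≢ v) × (∀ w → InClosedNbhd u w ⇔ InClosedNbhd v w)

  IsTwinCover : Subset n → Set
  IsTwinCover X = ∀ u v → u ∉ X → v ∉ X → Adj G u v → TrueTwins u v

  -- C is a connected component of G - X (a twin-clique when X is a twin cover)
  IsTwinClique : Subset n → Subset n → Set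
  IsTwinClique X C = ∃[ u ] (u ∉ X × (∀ v → (v ∈ C) ⇔ WalkIn (λ w → w ∉ X) u v))

  NX≡ : Subset n → Subset n → Subset n → Set
  NX≡ X C S = ∀ v → v ∈ C → ∀ x → (x ∈ S) ⇔ ((x ∈ X) × Adj G v x)

  IsM : Subset n → Subset n → ℕ → Set
  IsM X S k =
    ((∃[ C ] (IsTwinClique X C × NX≡ X C S × ∣ C ∣ ≡ k))
      × (∀ C → IsTwinClique X C → NX≡ X C S → ∣ C ∣ ≤ k))
    ⊎ ((∀ C → IsTwinClique X C → ¬ NX≡ X C S) × k ≡ 0)

  ProperOn : Subset n → (Fin n → ℕ) → Set
  ProperOn X c = ∀ u v → u ∈ X → v ∈ X → Adj G u v → c u ≢ c v

  ProperColoring : (Fin n → ℕ) → Set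
  ProperColoring c = ∀ u v → Adj G u v → c u ≢ c v

image : ∀ {n} → (Fin n → ℕ) → Subset n → List ℕ
image {n} c S = deduplicate ℕ._≟_ (map c (filter (_∈? S) (allFin n)))

imgCard : ∀ {n} → (Fin n → ℕ) → Subset n → ℕ
imgCard c S = length (image c S)

_⊆X_ : ∀ {n} → Subset n → Subset n → Set
S ⊆X X = ∀ {x} → x ∈ S → x ∈ X

module _ {n : ℕ} (G : Graph n) (X : Subset n) (φ : Fin n → ℕ) where

  Extends : (Fin n → ℕ) → Set
  Extends c = ∀ v → v ∈ X → c v ≡ φ v

  IsKφ : ℕ → Set
  IsKφ K =
    (∃[ S ] ∃[ k ] (S ⊆X X × IsM G X S k × K ≡ imgCard φ S + k))
    × (∀ S k → S ⊆X X → IsM G X S k → imgCard φ S + k ≤ K)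

  IsMinExtColors : ℕ → Set
  IsMinExtColors K =
    (∃[ c ] (ProperColoring G c × Extends c × imgCard c ⊤ ≡ K))
    × (∀ c → ProperColoring G c → Extends c → K ≤ imgCard c ⊤)

module Submission where

-- Lower bound: if C is a twin-clique with N_X(C) = S, then C is a clique all of whose vertices
-- are adjacent to all of S, so a proper extension of φ spends |φ(S)| colours on S and |C|
-- further, pairwise distinct colours on C.
-- Upper bound: colour each twin-clique C with N_X(C) = S first with the colours of φ(X) that
-- are missing from φ(S), then with fresh colours shared by all twin-cliques. Distinct
-- twin-cliques are non-adjacent, so this is proper, and it uses at most
-- max(|φ(X)|, max_C (|φ(N_X(C))| + |C|)) colours; each term of that maximum is bounded by some
-- |φ(S)| + m(S) (taking S = X for the first one), which closes the gap.

open import Defs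
open import Data.Nat using (ℕ)
open import Data.Fin using (Fin)
open import Data.Fin.Subset using (Subset)
open import Data.Product using (Σ; ∃; ∃-syntax; _×_)

open import Level using (0ℓ)
import Data.Bool as Bool
open import Data.Nat using (suc; _+_; _∸_; _≤_; _<_; z≤n; s≤s)
open import Data.Nat.Properties
open import Data.Fin using (toℕ)
import Data.Fin as F
open import Data.Fin.Properties using (toℕ<n; toℕ-injective; any?) renaming (_≟_ to _≟ᶠ_)
open import Data.Fin.Subset using (_∈_; _∉_; ⊤; ∣_∣; inside; outside)
open import Data.Fin.Subset.Properties using (_∈?_; ⊆-antisym; drop-there; ∈⊤)
open import Data.Vec using ([]; _∷_; here; there; tabulate)
open import Data.Vec.Properties using (lookup⇒[]=; []=⇒lookup; lookup∘tabulate; ≡-dec)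
open import Data.List using (List; []; _∷_; length; map; filter; allFin; upTo; _++_)
open import Data.List.Properties using (length-++; length-map; length-upTo; filter-notAll)
open import Data.List.Extrema.Nat using (max; argmax; argmax-all; f[xs]≤f[argmax]; ⊥≤max; xs≤max)
open import Data.List.Membership.Propositional using () renaming (_∈_ to _∈ₗ_)
open import Data.List.Membership.Propositional.Properties
open import Data.List.Membership.Setoid.Properties using (index-injective)
open import Data.List.Membership.DecPropositional _≟_ using () renaming (_∈?_ to _∈ℕ?_)
open import Data.List.Relation.Binary.Subset.Propositional using (_⊆_)
open import Data.List.Relation.Unary.Any as Any using (here; there)
open import Data.List.Relation.Unary.All as All using (All; _∷_)
import Data.List.Relation.Unary.All.Properties as All
open import Data.List.Relation.Unary.AllPairs using ([]; _∷_)
open import Data.List.Relation.Unary.Unique.Propositional using (Unique)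
open import Data.List.Relation.Unary.Unique.Propositional.Properties using (++⁺; filter⁺; allFin⁺)
open import Data.List.Relation.Unary.Unique.DecPropositional.Properties _≟_ using (deduplicate-!)
open import Data.Product using (_,_; proj₁; proj₂)
open import Data.Sum using (_⊎_; inj₁; inj₂)
open import Data.Empty using (⊥-elim)
open import Relation.Nullary using (¬_; yes; no; does; ¬?)
open import Relation.Nullary.Decidable using (_×-dec_; _⊎-dec_; dec-true)
open import Relation.Unary using (Pred; Decidable)
open import Relation.Binary.Definitions using (DecidableEquality)
open import Relation.Binary.PropositionalEquality
  using (_≡_; _≢_; refl; trans; cong; subst; setoid)
import Relation.Binary.PropositionalEquality as ≡
open import Function.Bundles using (_⇔_; mk⇔; Equivalence)
open Equivalence using (to; from)
open import Function using (_∘_; id)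

private variable
  A B : Set

module _ (_≟ₐ_ : DecidableEquality A) where

  Unique⇒length≤ : ∀ {xs ys : List A} → Unique xs → xs ⊆ ys → length xs ≤ length ys
  Unique⇒length≤ {[]} _ _ = z≤n
  Unique⇒length≤ {x ∷ xs} {ys} (x∉xs ∷ uxs) xs⊆ys =
    ≤-trans (s≤s (Unique⇒length≤ uxs xs⊆ys-x)) (filter-notAll ≢x? ys (Any.map (λ e ne → ne (≡.sym e)) (xs⊆ys (here refl))))
    where
    ≢x? : Decidable (_≢ x)
    ≢x? y = ¬? (y ≟ₐ x)
    xs⊆ys-x : xs ⊆ filter ≢x? ys
    xs⊆ys-x y∈xs = ∈-filter⁺ ≢x? (xs⊆ys (there y∈xs)) (λ { refl → All.lookup x∉xs y∈xs refl })

map⁺-injectiveOn : ∀ {f : A → B} {xs} → (∀ {x y} → x ∈ₗ xs → y ∈ₗ xs → f x ≡ f y → x ≡ y) →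
                   Unique xs → Unique (map f xs)
map⁺-injectiveOn {xs = []} _ [] = []
map⁺-injectiveOn {xs = x ∷ xs} inj (x∉xs ∷ uxs) =
  All.map⁺ (All.tabulate (λ y∈xs e → All.lookup x∉xs y∈xs (inj (here refl) (there y∈xs) e)))
  ∷ map⁺-injectiveOn (λ p q → inj (there p) (there q)) uxs

nthFrom : ℕ → List ℕ → ℕ → ℕ
nthFrom b []       r       = b + r
nthFrom b (x ∷ xs) 0       = x
nthFrom b (x ∷ xs) (suc r) = nthFrom b xs r

nthFrom-cases : ∀ b xs r →
  nthFrom b xs r ∈ₗ xs ⊎ (length xs ≤ r × nthFrom b xs r ≡ b + (r ∸ length xs))
nthFrom-cases b []       r       = inj₂ (z≤n , refl)
nthFrom-cases b (x ∷ xs) 0       = inj₁ (here refl)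
nthFrom-cases b (x ∷ xs) (suc r) with nthFrom-cases b xs r
... | inj₁ m        = inj₁ (there m)
... | inj₂ (le , e) = inj₂ (s≤s le , e)

nthFrom-∈⊎≥ : ∀ b xs r → nthFrom b xs r ∈ₗ xs ⊎ b ≤ nthFrom b xs r
nthFrom-∈⊎≥ b xs r with nthFrom-cases b xs r
... | inj₁ m       = inj₁ m
... | inj₂ (_ , e) = inj₂ (subst (b ≤_) (≡.sym e) (m≤m+n b _))

nthFrom-injective : ∀ {b xs} → Unique xs → All (_< b) xs →
                    ∀ r r' → nthFrom b xs r ≡ nthFrom b xs r' → r ≡ r'
nthFrom-injective {b} {[]} _ _ r r' e = +-cancelˡ-≡ b r r' e
nthFrom-injective {xs = x ∷ xs} _ _ 0 0 _ = refl
nthFrom-injective {b} {x ∷ xs} (x∉xs ∷ _) (x<b ∷ _) 0 (suc r') e with nthFrom-∈⊎≥ b xs r'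
... | inj₁ m  = ⊥-elim (All.lookup x∉xs m e)
... | inj₂ ge = ⊥-elim (<⇒≱ x<b (subst (b ≤_) (≡.sym e) ge))
nthFrom-injective {b} {x ∷ xs} (x∉xs ∷ _) (x<b ∷ _) (suc r) 0 e with nthFrom-∈⊎≥ b xs r
... | inj₁ m  = ⊥-elim (All.lookup x∉xs m (≡.sym e))
... | inj₂ ge = ⊥-elim (<⇒≱ x<b (subst (b ≤_) e ge))
nthFrom-injective {xs = x ∷ xs} (_ ∷ uxs) (_ ∷ xs<b) (suc r) (suc r') e =
  cong suc (nthFrom-injective uxs xs<b r r' e)

r∸q<t∸a : ∀ {r q c s a t} → q ≤ r → r < c → a ≤ q + s → s + c ≤ t → r ∸ q < t ∸ a
r∸q<t∸a {r} {q} {c} {s} {a} {t} q≤r r<c a≤q+s s+c≤t = m+n≤o⇒m≤o∸n (suc (r ∸ q)) (begin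
  suc (r ∸ q) + a        ≤⟨ +-monoʳ-≤ (suc (r ∸ q)) a≤q+s ⟩
  suc (r ∸ q + (q + s))  ≡⟨ cong suc (≡.sym (+-assoc (r ∸ q) q s)) ⟩
  suc (r ∸ q + q + s)    ≡⟨ cong (λ z → suc (z + s)) (m∸n+n≡m q≤r) ⟩
  suc r + s              ≤⟨ +-monoˡ-≤ s r<c ⟩
  c + s                  ≡⟨ +-comm c s ⟩
  s + c                  ≤⟨ s+c≤t ⟩
  t                      ∎)
  where open ≤-Reasoning

module _ {n : ℕ} where

  decSubset : ∀ {P : Pred (Fin n) 0ℓ} → Decidable P → Subset n
  decSubset P? = tabulate (λ i → does (P? i))

  ∈-decSubset : ∀ {P : Pred (Fin n) 0ℓ} (P? : Decidable P) {i} → i ∈ decSubset P? ⇔ P i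
  ∈-decSubset {P} P? {i} = mk⇔ to′ from′
    where
    to′ : i ∈ decSubset P? → P i
    to′ m with P? i | trans (≡.sym (lookup∘tabulate (λ j → does (P? j)) i)) ([]=⇒lookup m)
    ... | yes p | _ = p
    ... | no _  | ()
    from′ : P i → i ∈ decSubset P?
    from′ p = lookup⇒[]= i _ (trans (lookup∘tabulate _ i) (dec-true (P? i) p))

  subset-ext : ∀ {p q : Subset n} → (∀ x → x ∈ p ⇔ x ∈ q) → p ≡ q
  subset-ext e = ⊆-antisym (to (e _)) (from (e _))

  elements : Subset n → List (Fin n)
  elements p = filter (_∈? p) (allFin n)

  ∈-elements⁺ : ∀ {p x} → x ∈ p → x ∈ₗ elements p
  ∈-elements⁺ {p} {x} = ∈-filter⁺ (_∈? p) (∈-allFin x)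

  ∈-elements⁻ : ∀ {p x} → x ∈ₗ elements p → x ∈ p
  ∈-elements⁻ {p} m = proj₂ (∈-filter⁻ (_∈? p) {xs = allFin n} m)

  elements-unique : ∀ p → Unique (elements p)
  elements-unique p = filter⁺ (_∈? p) (allFin⁺ n)

private
  tail⇔ : ∀ {n b} {p : Subset n} {P : Pred A 0ℓ} {f : Fin (suc n) → A} →
          (∀ i → P (f i) ⇔ i ∈ (b ∷ p)) → ∀ i → P (f (F.suc i)) ⇔ i ∈ p
  tail⇔ e i = mk⇔ (drop-there ∘ to (e (F.suc i))) (from (e (F.suc i)) ∘ there)

length-filter-tabulate : ∀ {n} (p : Subset n) {P : Pred A 0ℓ} (P? : Decidable P) (f : Fin n → A) →
                         (∀ i → P (f i) ⇔ i ∈ p) → length (filter P? (Data.List.tabulate f)) ≡ ∣ p ∣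
length-filter-tabulate []           P? f e = refl
length-filter-tabulate (inside ∷ p) {P} P? f e with P? (f F.zero)
... | yes _ = cong suc (length-filter-tabulate p P? (f ∘ F.suc) (tail⇔ {P = P} {f = f} e))
... | no ¬P = ⊥-elim (¬P (from (e F.zero) here))
length-filter-tabulate (outside ∷ p) {P} P? f e with P? (f F.zero)
... | yes P0 with () ← to (e F.zero) P0
... | no _ = length-filter-tabulate p P? (f ∘ F.suc) (tail⇔ {P = P} {f = f} e)

length-elements : ∀ {n} (p : Subset n) → length (elements p) ≡ ∣ p ∣
length-elements p = length-filter-tabulate p (_∈? p) id (λ _ → mk⇔ id id)

module _ {n : ℕ} where

  ∈-image⁺ : ∀ (f : Fin n → ℕ) {S x} → x ∈ S → f x ∈ₗ image f S
  ∈-image⁺ f m = ∈-deduplicate⁺ _≟_ (∈-map⁺ f (∈-elements⁺ m))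

  ∈-image⁻ : ∀ (f : Fin n → ℕ) {S y} → y ∈ₗ image f S → ∃[ x ] (x ∈ S × y ≡ f x)
  ∈-image⁻ f {S} m with ∈-map⁻ f (∈-deduplicate⁻ _≟_ _ m)
  ... | x , x∈ , e = x , ∈-elements⁻ x∈ , e

  image-unique : ∀ (f : Fin n → ℕ) S → Unique (image f S)
  image-unique f S = deduplicate-! _

module _ {n : ℕ} {G : Graph n} where

  walk-head : ∀ {P u v} → WalkIn G P u v → P u
  walk-head (here p)     = p
  walk-head (step p _ _) = p

  walk-last : ∀ {P u v} → WalkIn G P u v → P v
  walk-last (here p)     = p
  walk-last (step _ _ w) = walk-last w

module _ {n : ℕ} (G : Graph n) where

  twin-adj : ∀ {u v x} → TrueTwins G u v → x ≢ v → Adj G u x → Adj G v x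
  twin-adj (_ , N≡) x≢v a with to (N≡ _) (inj₂ a)
  ... | inj₁ x≡v = ⊥-elim (x≢v x≡v)
  ... | inj₂ a'  = a'

module TwinCover {n : ℕ} (G : Graph n) (X : Subset n) (tc : IsTwinCover G X) where

  walk⇒closedNbhd : ∀ {u v} → WalkIn G (_∉ X) u v → InClosedNbhd G u v
  walk⇒closedNbhd (here _) = inj₁ refl
  walk⇒closedNbhd (step {u} {w} u∉X a rest) with walk⇒closedNbhd rest
  ... | inj₁ refl = inj₂ a
  ... | inj₂ a'   = from (proj₂ (tc u w u∉X (walk-head rest) a) _) (inj₂ a')

  closedNbhd⇒walk : ∀ {u v} → u ∉ X → v ∉ X → InClosedNbhd G u v → WalkIn G (_∉ X) u v
  closedNbhd⇒walk u∉X v∉X (inj₁ refl) = here v∉X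
  closedNbhd⇒walk u∉X v∉X (inj₂ a)    = step u∉X a (here v∉X)

  closedNbhd-clique : ∀ {u v w} → u ∉ X → v ∉ X → InClosedNbhd G u v → InClosedNbhd G u w →
                      v ≢ w → Adj G v w
  closedNbhd-clique _ _ (inj₁ refl) (inj₁ refl) v≢w = ⊥-elim (v≢w refl)
  closedNbhd-clique _ _ (inj₁ refl) (inj₂ a)    _   = a
  closedNbhd-clique {u} {v} u∉X v∉X (inj₂ a) w∈N[u] v≢w with to (proj₂ (tc u v u∉X v∉X a) _) w∈N[u]
  ... | inj₁ w≡v = ⊥-elim (v≢w (≡.sym w≡v))
  ... | inj₂ a'  = a'

  outside? : Decidable (_∉ X)
  outside? v = ¬? (v ∈? X)

  ∈X⇒≢∉X : ∀ {x y} → x ∈ X → y ∉ X → x ≢ y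
  ∈X⇒≢∉X x∈X y∉X refl = y∉X x∈X

  InComponent : Fin n → Fin n → Set
  InComponent u w = w ∉ X × InClosedNbhd G u w

  InNbhdX : Fin n → Fin n → Set
  InNbhdX u x = x ∈ X × Adj G u x

  inComponent? : ∀ u → Decidable (InComponent u)
  inComponent? u w = outside? w ×-dec ((w ≟ᶠ u) ⊎-dec dec G u w)

  inNbhdX? : ∀ u → Decidable (InNbhdX u)
  inNbhdX? u x = (x ∈? X) ×-dec dec G u x

  -- For u ∉ X, component u is the twin-clique of u and nbhdX u is its N_X.
  component : Fin n → Subset n
  component u = decSubset (inComponent? u)

  ∈-component : ∀ u {w} → w ∈ component u ⇔ InComponent u w
  ∈-component u = ∈-decSubset (inComponent? u)

  nbhdX : Fin n → Subset n
  nbhdX u = decSubset (inNbhdX? u)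

  ∈-nbhdX : ∀ u {x} → x ∈ nbhdX u ⇔ InNbhdX u x
  ∈-nbhdX u = ∈-decSubset (inNbhdX? u)

  ∈-component⇔walk : ∀ {u v} → u ∉ X → v ∈ component u ⇔ WalkIn G (_∉ X) u v
  ∈-component⇔walk {u} u∉X = mk⇔
    (λ m → let v∉X , v∈N[u] = to (∈-component u) m in closedNbhd⇒walk u∉X v∉X v∈N[u])
    (λ w → from (∈-component u) (walk-last w , walk⇒closedNbhd w))

  component-isTwinClique : ∀ {u} → u ∉ X → IsTwinClique G X (component u)
  component-isTwinClique {u} u∉X = u , u∉X , λ _ → ∈-component⇔walk u∉X

  component-NX : ∀ {u} → u ∉ X → NX≡ G X (component u) (nbhdX u)
  component-NX {u} u∉X v v∈C x with to (∈-component u) v∈C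
  ... | _   , inj₁ refl = ∈-nbhdX u
  ... | v∉X , inj₂ a    = mk⇔
    (λ m → let x∈X , ux = to (∈-nbhdX u) m in x∈X , twin-adj G (tc u v u∉X v∉X a) (∈X⇒≢∉X x∈X v∉X) ux)
    (λ (x∈X , vx) → from (∈-nbhdX u) (x∈X , twin-adj G (tc v u v∉X u∉X (Graph.sym G a)) (∈X⇒≢∉X x∈X u∉X) vx))

  HasNbhdX : Subset n → Fin n → Set
  HasNbhdX S u = u ∉ X × nbhdX u ≡ S

  hasNbhdX? : ∀ S → Decidable (HasNbhdX S)
  hasNbhdX? S u = outside? u ×-dec ≡-dec Bool._≟_ (nbhdX u) S

  twinClique⇒component : ∀ {C S} → IsTwinClique G X C → NX≡ G X C S →
                         ∃[ u ] (HasNbhdX S u × C ≡ component u)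
  twinClique⇒component {C} {S} (u , u∉X , C⇔walk) NX = u , (u∉X , nbhdX≡S) , C≡component
    where
    u∈C : u ∈ C
    u∈C = from (C⇔walk u) (here u∉X)
    nbhdX≡S : nbhdX u ≡ S
    nbhdX≡S = subset-ext λ x → mk⇔ (from (NX u u∈C x) ∘ to (∈-nbhdX u)) (from (∈-nbhdX u) ∘ to (NX u u∈C x))
    C≡component : C ≡ component u
    C≡component = subset-ext λ v →
      mk⇔ (from (∈-component⇔walk u∉X) ∘ to (C⇔walk v)) (from (C⇔walk v) ∘ to (∈-component⇔walk u∉X))

  twinClique-adj : ∀ {C v w} → IsTwinClique G X C → v ∈ C → w ∈ C → v ≢ w → Adj G v w
  twinClique-adj {v = v} {w} (u , u∉X , C⇔walk) v∈C w∈C =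
    closedNbhd-clique u∉X (walk-last u⇝v) (walk⇒closedNbhd u⇝v) (walk⇒closedNbhd (to (C⇔walk w) w∈C))
    where
    u⇝v : WalkIn G (_∉ X) u v
    u⇝v = to (C⇔walk v) v∈C

  module _ {u v} (u∉X : u ∉ X) (v∉X : v ∉ X) (uv : Adj G u v) where

    adjacent⇒same-component : component u ≡ component v
    adjacent⇒same-component = subset-ext λ w → mk⇔
      (λ m → let w∉X , w∈N[u] = to (∈-component u) m in from (∈-component v) (w∉X , to (N[u]⇔N[v] w) w∈N[u]))
      (λ m → let w∉X , w∈N[v] = to (∈-component v) m in from (∈-component u) (w∉X , from (N[u]⇔N[v] w) w∈N[v]))
      where
      N[u]⇔N[v] : ∀ w → InClosedNbhd G u w ⇔ InClosedNbhd G v w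
      N[u]⇔N[v] = proj₂ (tc u v u∉X v∉X uv)

    adjacent⇒same-nbhdX : nbhdX u ≡ nbhdX v
    adjacent⇒same-nbhdX = subset-ext λ x →
      mk⇔ (from (∈-nbhdX v) ∘ to (NX x)) (from (NX x) ∘ to (∈-nbhdX v))
      where
      NX : ∀ x → x ∈ nbhdX u ⇔ InNbhdX v x
      NX = component-NX u∉X v (from (∈-component u) (v∉X , inj₂ uv))

  m-exists : ∀ S → ∃[ k ] IsM G X S k
  m-exists S with any? (hasNbhdX? S)
  ... | no ∄u = 0 , inj₂ ((λ C isTC NX → ∄u (let u , hu , _ = twinClique⇒component isTC NX in u , hu)) , refl)
  ... | yes (u , hu) = size w , inj₁ ((component w , component-isTwinClique w∉X , NX , refl) , largest)
    where
    size : Fin n → ℕ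
    size v = ∣ component v ∣
    candidates : List (Fin n)
    candidates = filter (hasNbhdX? S) (allFin n)
    w : Fin n
    w = argmax size u candidates
    hw : HasNbhdX S w
    hw = argmax-all size hu (All.all-filter (hasNbhdX? S) (allFin n))
    w∉X : w ∉ X
    w∉X = proj₁ hw
    NX : NX≡ G X (component w) S
    NX = subst (NX≡ G X (component w)) (proj₂ hw) (component-NX w∉X)
    largest : ∀ C → IsTwinClique G X C → NX≡ G X C S → ∣ C ∣ ≤ size w
    largest C isTC NX with twinClique⇒component isTC NX
    ... | v , hv , refl = All.lookup (f[xs]≤f[argmax] {f = size} u candidates) (∈-filter⁺ (hasNbhdX? S) (∈-allFin v) hv)

  IsM⇒size≤ : ∀ {S k C} → IsM G X S k → IsTwinClique G X C → NX≡ G X C S → ∣ C ∣ ≤ k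
  IsM⇒size≤ (inj₁ (_ , largest)) isTC NX = largest _ isTC NX
  IsM⇒size≤ (inj₂ (none , _))    isTC NX = ⊥-elim (none _ isTC NX)

  module _ {φ c : Fin n → ℕ} (c-proper : ProperColoring G c) (c-extends : Extends G X φ c) where

    image⊆colours : ∀ {S} → S ⊆X X → image φ S ⊆ image c ⊤
    image⊆colours S⊆X m with ∈-image⁻ φ m
    ... | x , x∈S , refl = subst (_∈ₗ image c ⊤) (c-extends x (S⊆X x∈S)) (∈-image⁺ c ∈⊤)

    twinClique-colours : ∀ {S C} → S ⊆X X → IsTwinClique G X C → NX≡ G X C S →
                         imgCard φ S + ∣ C ∣ ≤ imgCard c ⊤
    twinClique-colours {S} {C} S⊆X isTC NX = begin
      imgCard φ S + ∣ C ∣                         ≡⟨ ≡.sym length-colours ⟩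
      length (image φ S ++ map c (elements C))  ≤⟨ Unique⇒length≤ _≟_ unique colours⊆ ⟩
      imgCard c ⊤                               ∎
      where
      open ≤-Reasoning
      length-colours : length (image φ S ++ map c (elements C)) ≡ imgCard φ S + ∣ C ∣
      length-colours = begin-equality
        length (image φ S ++ map c (elements C)) ≡⟨ length-++ (image φ S) ⟩
        imgCard φ S + length (map c (elements C)) ≡⟨ cong (imgCard φ S +_) (length-map c (elements C)) ⟩
        imgCard φ S + length (elements C)         ≡⟨ cong (imgCard φ S +_) (length-elements C) ⟩
        imgCard φ S + ∣ C ∣                       ∎
      c-injective : ∀ {v w} → v ∈ₗ elements C → w ∈ₗ elements C → c v ≡ c w → v ≡ w
      c-injective {v} {w} v∈C w∈C e with v ≟ᶠ w
      ... | yes v≡w = v≡w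
      ... | no  v≢w = ⊥-elim (c-proper v w (twinClique-adj isTC (∈-elements⁻ v∈C) (∈-elements⁻ w∈C) v≢w) e)
      -- a vertex of C is adjacent to every vertex of S
      disjoint : ∀ {y} → ¬ (y ∈ₗ image φ S × y ∈ₗ map c (elements C))
      disjoint (y∈φS , y∈cC) with ∈-image⁻ φ y∈φS | ∈-map⁻ c y∈cC
      ... | x , x∈S , refl | v , v∈C , φx≡cv =
        c-proper v x (proj₂ (to (NX v (∈-elements⁻ v∈C) x) x∈S)) (trans (≡.sym φx≡cv) (≡.sym (c-extends x (S⊆X x∈S))))
      unique : Unique (image φ S ++ map c (elements C))
      unique = ++⁺ (image-unique φ S) (map⁺-injectiveOn c-injective (elements-unique C)) disjoint
      colours⊆ : image φ S ++ map c (elements C) ⊆ image c ⊤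
      colours⊆ m with ∈-++⁻ (image φ S) m
      ... | inj₁ y∈φS = image⊆colours S⊆X y∈φS
      ... | inj₂ y∈cC with ∈-map⁻ c y∈cC
      ...   | v , _ , refl = ∈-image⁺ c ∈⊤

    extension-colours≥ : ∀ {S k} → S ⊆X X → IsM G X S k → imgCard φ S + k ≤ imgCard c ⊤
    extension-colours≥ S⊆X (inj₁ ((C , isTC , NX , refl) , _)) = twinClique-colours S⊆X isTC NX
    extension-colours≥ {S} S⊆X (inj₂ (_ , refl)) =
      subst (_≤ imgCard c ⊤) (≡.sym (+-identityʳ _)) (Unique⇒length≤ _≟_ (image-unique φ S) (image⊆colours S⊆X))

module Extension {n : ℕ} (G : Graph n) (X : Subset n) (tc : IsTwinCover G X)
                 (φ : Fin n → ℕ) (φ-proper : ProperOn G X φ) where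

  open TwinCover G X tc

  palette : List ℕ
  palette = image φ X

  fresh : ℕ
  fresh = suc (max 0 (map φ (allFin n)))

  φ<fresh : ∀ x → φ x < fresh
  φ<fresh x = s≤s (All.lookup (xs≤max 0 (map φ (allFin n))) (∈-map⁺ φ (∈-allFin x)))

  palette<fresh : All (_< fresh) palette
  palette<fresh = All.tabulate λ m → let x , _ , y≡φx = ∈-image⁻ φ m in subst (_< fresh) (≡.sym y≡φx) (φ<fresh x)

  unused? : ∀ S → Decidable (λ y → ¬ y ∈ₗ image φ S)
  unused? S y = ¬? (y ∈ℕ? image φ S)

  spare : Subset n → List ℕ
  spare S = filter (unused? S) palette

  module _ (S : Subset n) where

    spare-unique : Unique (spare S)
    spare-unique = filter⁺ (unused? S) (image-unique φ X)

    ∈-spare⁻ : ∀ {y} → y ∈ₗ spare S → y ∈ₗ palette × ¬ y ∈ₗ image φ S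
    ∈-spare⁻ = ∈-filter⁻ (unused? S) {xs = palette}

    palette≤spare+image : length palette ≤ length (spare S) + imgCard φ S
    palette≤spare+image = subst (length palette ≤_) (length-++ (spare S))
      (Unique⇒length≤ _≟_ (image-unique φ X) palette⊆)
      where
      palette⊆ : palette ⊆ spare S ++ image φ S
      palette⊆ {y} y∈P with y ∈ℕ? image φ S
      ... | yes y∈φS = ∈-++⁺ʳ (spare S) y∈φS
      ... | no  y∉φS = ∈-++⁺ˡ (∈-filter⁺ (unused? S) y∈P y∉φS)

  cliqueColour : (C S : Subset n) {v : Fin n} → v ∈ₗ elements C → ℕ
  cliqueColour C S v∈C = nthFrom fresh (spare S) (toℕ (Any.index v∈C))

  module _ {C S : Subset n} where

    cliqueColour-avoids : ∀ {v x} (v∈C : v ∈ₗ elements C) → x ∈ S → cliqueColour C S v∈C ≢ φ x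
    cliqueColour-avoids {x = x} v∈C x∈S e with nthFrom-∈⊎≥ fresh (spare S) (toℕ (Any.index v∈C))
    ... | inj₁ y∈spare = proj₂ (∈-spare⁻ S y∈spare) (subst (_∈ₗ image φ S) (≡.sym e) (∈-image⁺ φ x∈S))
    ... | inj₂ fresh≤y = <⇒≱ (φ<fresh x) (subst (fresh ≤_) e fresh≤y)

    cliqueColour-injective : ∀ {u v} (u∈C : u ∈ₗ elements C) (v∈C : v ∈ₗ elements C) →
                             cliqueColour C S u∈C ≡ cliqueColour C S v∈C → u ≡ v
    cliqueColour-injective u∈C v∈C e = index-injective (setoid (Fin n)) u∈C v∈C
      (toℕ-injective (nthFrom-injective (spare-unique S) (All.filter⁺ _ palette<fresh) _ _ e))

  cliqueColour-subst : ∀ {C C' S S' v} (C≡C' : C ≡ C') (S≡S' : S ≡ S') (v∈C : v ∈ₗ elements C) →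
    cliqueColour C S v∈C ≡ cliqueColour C' S' (subst (λ D → v ∈ₗ elements D) C≡C' v∈C)
  cliqueColour-subst refl refl v∈C = refl

  self∈component : ∀ {v} → v ∉ X → v ∈ₗ elements (component v)
  self∈component {v} v∉X = ∈-elements⁺ (from (∈-component v) (v∉X , inj₁ refl))

  cliqueColour-proper : ∀ {u v} (u∉X : u ∉ X) (v∉X : v ∉ X) → Adj G u v →
    cliqueColour (component u) (nbhdX u) (self∈component u∉X) ≢ cliqueColour (component v) (nbhdX v) (self∈component v∉X)
  cliqueColour-proper {u} {v} u∉X v∉X uv e = Graph.irrefl G v (subst (λ w → Adj G w v) u≡v uv)
    where
    C≡ : component v ≡ component u
    C≡ = ≡.sym (adjacent⇒same-component u∉X v∉X uv)
    v∈Cu : v ∈ₗ elements (component u)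
    v∈Cu = subst (λ D → v ∈ₗ elements D) C≡ (self∈component v∉X)
    u≡v : u ≡ v
    u≡v = cliqueColour-injective (self∈component u∉X) v∈Cu
      (trans e (cliqueColour-subst C≡ (≡.sym (adjacent⇒same-nbhdX u∉X v∉X uv)) (self∈component v∉X)))

  colour : Fin n → ℕ
  colour v with v ∈? X
  ... | yes _   = φ v
  ... | no  v∉X = cliqueColour (component v) (nbhdX v) (self∈component v∉X)

  colour-extends : Extends G X φ colour
  colour-extends v v∈X with v ∈? X
  ... | yes _   = refl
  ... | no  v∉X = ⊥-elim (v∉X v∈X)

  colour-proper : ProperColoring G colour
  colour-proper u v uv with u ∈? X | v ∈? X
  ... | yes u∈X | yes v∈X = φ-proper u v u∈X v∈X uv
  ... | yes u∈X | no  v∉X = cliqueColour-avoids (self∈component v∉X) (from (∈-nbhdX v) (u∈X , Graph.sym G uv)) ∘ ≡.sym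
  ... | no  u∉X | yes v∈X = cliqueColour-avoids (self∈component u∉X) (from (∈-nbhdX u) (v∈X , uv))
  ... | no  u∉X | no  v∉X = cliqueColour-proper u∉X v∉X uv

  score : Fin n → ℕ
  score v = imgCard φ (nbhdX v) + ∣ component v ∣

  verticesOutside : List (Fin n)
  verticesOutside = filter outside? (allFin n)

  bound : ℕ
  bound = max (length palette) (map score verticesOutside)

  score≤bound : ∀ {v} → v ∉ X → score v ≤ bound
  score≤bound {v} v∉X = All.lookup (xs≤max (length palette) (map score verticesOutside))
    (∈-map⁺ score (∈-filter⁺ outside? (∈-allFin v) v∉X))

  freshCount : ℕ
  freshCount = bound ∸ length palette

  colourRange : List ℕ
  colourRange = palette ++ map (fresh +_) (upTo freshCount)

  length-colourRange : length colourRange ≡ bound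
  length-colourRange = begin
    length colourRange                                   ≡⟨ length-++ palette ⟩
    length palette + length (map (fresh +_) (upTo freshCount))
      ≡⟨ cong (length palette +_) (length-map (fresh +_) (upTo freshCount)) ⟩
    length palette + length (upTo freshCount)            ≡⟨ cong (length palette +_) (length-upTo freshCount) ⟩
    length palette + freshCount                          ≡⟨ m+[n∸m]≡n (⊥≤max (length palette) (map score verticesOutside)) ⟩
    bound                                                ∎
    where open ≡.≡-Reasoning

  cliqueColour∈colourRange : ∀ {C S v} (v∈C : v ∈ₗ elements C) → imgCard φ S + ∣ C ∣ ≤ bound →
                             cliqueColour C S v∈C ∈ₗ colourRange
  cliqueColour∈colourRange {C} {S} v∈C budget with nthFrom-cases fresh (spare S) (toℕ (Any.index v∈C))
  ... | inj₁ y∈spare  = ∈-++⁺ˡ (proj₁ (∈-spare⁻ S y∈spare))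
  ... | inj₂ (q≤r , e) = subst (_∈ₗ colourRange) (≡.sym e) (∈-++⁺ʳ palette (∈-map⁺ (fresh +_) (∈-upTo⁺
      (r∸q<t∸a q≤r r<∣C∣ (palette≤spare+image S) budget))))
    where
    r<∣C∣ : toℕ (Any.index v∈C) < ∣ C ∣
    r<∣C∣ = subst (toℕ (Any.index v∈C) <_) (length-elements C) (toℕ<n (Any.index v∈C))

  colour∈colourRange : ∀ v → colour v ∈ₗ colourRange
  colour∈colourRange v with v ∈? X
  ... | yes v∈X = ∈-++⁺ˡ (∈-image⁺ φ v∈X)
  ... | no  v∉X = cliqueColour∈colourRange (self∈component v∉X) (score≤bound v∉X)

  colours≤bound : imgCard colour ⊤ ≤ bound
  colours≤bound = subst (imgCard colour ⊤ ≤_) length-colourRange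
    (Unique⇒length≤ _≟_ (image-unique colour ⊤) λ m → let v , _ , y≡ = ∈-image⁻ colour m in
      subst (_∈ₗ colourRange) (≡.sym y≡) (colour∈colourRange v))

  Attained : ℕ → Set
  Attained t = ∃[ S ] ∃[ k ] (S ⊆X X × IsM G X S k × t ≤ imgCard φ S + k)

  bound-attained : Attained bound
  bound-attained = argmax-all id {P = Attained} palette-attained
    (All.map⁺ (All.tabulate λ m → score-attained (proj₂ (∈-filter⁻ outside? {xs = allFin n} m))))
    where
    palette-attained : Attained (length palette)
    palette-attained = let k , isM = m-exists X in X , k , id , isM , m≤m+n _ k
    score-attained : ∀ {v} → v ∉ X → Attained (score v)
    score-attained {v} v∉X = let k , isM = m-exists (nbhdX v) in
      nbhdX v , k , (λ m → proj₁ (to (∈-nbhdX v) m)) , isM ,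
      +-monoʳ-≤ _ (IsM⇒size≤ isM (component-isTwinClique v∉X) (component-NX v∉X))

theorem3 : ∀ {n} (G : Graph n) (X : Subset n) (φ : Fin n → ℕ) →
    Connected G → IsTwinCover G X → ProperOn G X φ →
    ∃[ K ] (IsKφ G X φ K × IsMinExtColors G X φ K)
theorem3 G X φ _ tc φ-proper with Extension.bound-attained G X tc φ φ-proper
... | S , k , S⊆X , isM , bound≤ =
  imgCard colour ⊤ , ((S , k , S⊆X , isM , K≡) , λ _ _ → colours≥ colour-proper colour-extends)
                   , ((colour , colour-proper , colour-extends , refl) ,
                      λ c c-proper c-extends → subst (_≤ imgCard c ⊤) (≡.sym K≡) (colours≥ c-proper c-extends S⊆X isM))
  where
  open TwinCover G X tc using () renaming (extension-colours≥ to colours≥)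
  open Extension G X tc φ φ-proper
  K≡ : imgCard colour ⊤ ≡ imgCard φ S + k
  K≡ = ≤-antisym (≤-trans colours≤bound bound≤) (colours≥ colour-proper colour-extends S⊆X isM)
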